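{- If $A\in\mathcal L_{\land,\mathsf F,\mathsf P}$, then the schematic labeled sequent $\varphi_{\dot w}(A)$ forms a polytree.
   Context: $\mathcal L_{\land,\mathsf F,\mathsf P}$ is the set of formulae generated by $A::=p\mid\top\mid(A\land A)\mid\mathsf FA\mid\mathsf PA$ with $p$ ranging over atoms. Schematic labeled sequents are built from schematic relational atoms $R\dot w\dot u$ (with $\dot w,\dot u$ label variables) and labeled sequent variables using the composition $\otimes$ (where $(\mathcal R_1,\Gamma_1\Rightarrow\Delta_1)\otimes(\mathcal R_2,\Gamma_2\Rightarrow\Delta_2)=(\mathcal R_1\cup\mathcal R_2,\Gamma_1\uplus\Gamma_2\Rightarrow\Delta_1\uplus\Delta_2)$). Define $\varphi_{\dot w}(\top)=(\emptyset\Rightarrow\emptyset)$; $\varphi_{\dot w}(p)=\dot\Lambda^{\dot w}_p$, a new labeled sequent variable annotated with $p$ and $\dot w$ (each occurrence a distinct variable); $\varphi_{\dot w}(A\land B)=\varphi_{\dot w}(A)\otimes\varphi_{\dot w}(B)$; $\varphi_{\dot w}(\mathsf FA)=(R\dot w\dot u\Rightarrow\emptyset)\otimes\varphi_{\dot u}(A)$ and $\varphi_{\dot w}(\mathsf PA)=(R\dot u\dot w\Rightarrow\emptyset)\otimes\varphi_{\dot u}(A)$ where $\dot u$ is a new label variable. The graph of a schematic labeled sequent $\dot\Lambda$ has as nodes the pairs $(\dot w,X)$ with $\dot w$ a label variable occurring in $\dot\Lambda$ and $X$ the set of labeled sequent variables $\dot\Lambda^{\dot w}_p$ occurring in $\dot\Lambda$,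 and an edge $(\dot w,\dot u)$ for each $R\dot w\dot u$ occurring in $\dot\Lambda$. It forms a polytree iff its graph is connected and free of directed and undirected cycles. -}

module Defs where

open import Data.Nat using (ℕ; suc; _<_)
open import Data.Bool using (Bool; true; false)
open import Data.Fin using (Fin)
open import Data.List using (List; []; _∷_; _++_; length; lookup; map; filter)
open import Data.List.Relation.Unary.Any using (Any)
open import Data.List.Relation.Unary.All using (All)
open import Data.List.Relation.Unary.Unique.Propositional using (Unique)
open import Data.Product using (_×_; _,_; proj₁; proj₂; ∃; ∃-syntax)
open import Data.Sum using (_⊎_)
open import Relation.Binary.PropositionalEquality using (_≡_; _≢_)
open import Relation.Nullary using (¬_)

Atom : Set
Atom = ℕ

LabelVar : Set
LabelVar = ℕ

data Fm : Set where
  atom : Atom → Fm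
  ⊤ᶠ   : Fm
  _∧ᶠ_ : Fm → Fm → Fm
  F    : Fm → Fm
  P    : Fm → Fm

record SeqVar : Set where
  constructor seqVar
  field
    ident : ℕ
    annAtom : Atom
    annLabel : LabelVar
open SeqVar public

-- A schematic labeled sequent: a composition (⊗) of schematic relational
-- atoms R w u (stored as pairs (w , u)) and labeled sequent variables.
record SchSeq : Set where
  constructor sch
  field
    rels : List (LabelVar × LabelVar)
    vars : List SeqVar
open SchSeq public

emptyS : SchSeq
emptyS = sch [] []

relS : LabelVar → LabelVar → SchSeq
relS w u = sch ((w , u) ∷ []) []

_⊗_ : SchSeq → SchSeq → SchSeq
sch r₁ v₁ ⊗ sch r₂ v₂ = sch (r₁ ++ r₂) (v₁ ++ v₂)

-- φ_w(A), with a fresh-name supply n (all names ≥ n are unused).  Fresh label variables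
-- and fresh sequent-variable identifiers are both drawn from the supply.
φ : LabelVar → Fm → ℕ → SchSeq × ℕ
φ w (atom p) n = sch [] (seqVar n p w ∷ []) , suc n
φ w ⊤ᶠ n = emptyS , n
φ w (A ∧ᶠ B) n =
  let r₁ = φ w A n
      r₂ = φ w B (proj₂ r₁)
  in (proj₁ r₁ ⊗ proj₁ r₂) , proj₂ r₂
φ w (F A) n =
  let r = φ n A (suc n)
  in (relS w n ⊗ proj₁ r) , proj₂ r
φ w (P A) n =
  let r = φ n A (suc n)
  in (relS n w ⊗ proj₁ r) , proj₂ r

Occurs : SchSeq → LabelVar → Set
Occurs Λ w =
  Any (λ e → proj₁ e ≡ w ⊎ proj₂ e ≡ w) (rels Λ) ⊎ Any (λ v → annLabel v ≡ w) (vars Λ)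

-- the node (w , X): X = the labeled sequent variables annotated with w
-- (recorded for completeness; nodes are identified by their label variable)
nodeVars : SchSeq → LabelVar → List SeqVar
nodeVars Λ w = filter (λ v → annLabel v Data.Nat.≟ w) (vars Λ)

Edge : SchSeq → Set
Edge Λ = Fin (length (rels Λ))

-- a traversal step: an edge and a direction (true = along, false = against)
Step : SchSeq → Set
Step Λ = Edge Λ × Bool

src : (Λ : SchSeq) → Step Λ → LabelVar
src Λ (i , true)  = proj₁ (lookup (rels Λ) i)
src Λ (i , false) = proj₂ (lookup (rels Λ) i)

tgt : (Λ : SchSeq) → Step Λ → LabelVar
tgt Λ (i , true)  = proj₂ (lookup (rels Λ) i)
tgt Λ (i , false) = proj₁ (lookup (rels Λ) i)

data Walk (Λ : SchSeq) : LabelVar → LabelVar → List (Step Λ) → Set where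
  nil  : ∀ {x} → Walk Λ x x []
  cons : ∀ {y ss} (s : Step Λ) → Walk Λ (tgt Λ s) y ss → Walk Λ (src Λ s) y (s ∷ ss)

Connected : SchSeq → Set
Connected Λ = ∀ x y → Occurs Λ x → Occurs Λ y → ∃[ ss ] Walk Λ x y ss

UndirectedCycle : SchSeq → Set
UndirectedCycle Λ =
  ∃[ x ] ∃[ ss ] (ss ≢ [] × Unique (map proj₁ ss) × Walk Λ x x ss)

DirectedCycle : SchSeq → Set
DirectedCycle Λ =
  ∃[ x ] ∃[ ss ] (ss ≢ [] × Unique (map proj₁ ss) × All (λ s → proj₂ s ≡ true) ss
                  × Walk Λ x x ss)

Polytree : SchSeq → Set
Polytree Λ = Connected Λ × ¬ DirectedCycle Λ × ¬ UndirectedCycle Λ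

-- Every relational atom created by φ joins an existing label to a fresh one, and fresh labels
-- exceed all earlier ones.  So each label is the larger endpoint of at most one relational
-- atom (the atom that created it), and every label is joined to the root w by a path.  An
-- undirected walk that never reuses an atom cannot arrive at a label ascending (through the
-- label's creating atom) and then leave it descending (through that same atom), so it
-- descends first and then ascends; such a walk can never return to its starting label.
module Submission where

open import Defs
open import Data.Nat using (ℕ; suc; _<_; _≤_; _⊔_)
open import Data.Nat.Properties
  using (≤-refl; ≤-trans; <⇒≤; <⇒≢; >⇒≢; <-irrefl; <-asym; <-trans; <-≤-trans; <-cmp;
         n<1+n; n≤1+n; m≤n⇒m⊔n≡n; m≥n⇒m⊔n≡m)
open import Data.Bool using (true; false)
open import Data.Fin using (Fin; zero; suc)
open import Data.List using (List; []; _∷_; _++_; length; lookup; map)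
open import Data.List.Membership.Propositional.Properties using (∈-lookup)
open import Data.List.Relation.Unary.Any using (Any; here; there)
import Data.List.Relation.Unary.Any.Properties as Any
open import Data.List.Relation.Unary.All using (All; []; _∷_)
import Data.List.Relation.Unary.All as All
import Data.List.Relation.Unary.All.Properties as All
open import Data.List.Relation.Unary.AllPairs using (AllPairs; []; _∷_)
import Data.List.Relation.Unary.AllPairs.Properties as AllPairs
open import Data.List.Relation.Unary.Unique.Propositional using (Unique)
open import Data.Product using (_×_; _,_; proj₁; proj₂; ∃-syntax)
open import Data.Sum using (_⊎_; inj₁; inj₂)
open import Data.Empty using (⊥-elim)
open import Relation.Binary.PropositionalEquality using (_≡_; _≢_; refl; sym; trans; cong; subst)
open import Relation.Binary.Definitions using (tri<; tri≈; tri>)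
open import Relation.Nullary using (¬_)

Reach : SchSeq → LabelVar → LabelVar → Set
Reach Λ x y = ∃[ ss ] Walk Λ x y ss

module _ {Λ : SchSeq} where

  reach-refl : ∀ {x} → Reach Λ x x
  reach-refl = [] , nil

  reach-step : (s : Step Λ) → Reach Λ (src Λ s) (tgt Λ s)
  reach-step s = s ∷ [] , cons s nil

  reach-step-back : (s : Step Λ) → Reach Λ (tgt Λ s) (src Λ s)
  reach-step-back (i , true)  = reach-step (i , false)
  reach-step-back (i , false) = reach-step (i , true)

  reach-trans : ∀ {x y z} → Reach Λ x y → Reach Λ y z → Reach Λ x z
  reach-trans (_ , nil) r = r
  reach-trans (_ , cons s w) r with reach-trans (_ , w) r
  ... | ss , w′ = s ∷ ss , cons s w′

  reach-sym : ∀ {x y} → Reach Λ x y → Reach Λ y x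
  reach-sym (_ , nil)      = reach-refl
  reach-sym (_ , cons s w) = reach-trans (reach-sym (_ , w)) (reach-step-back s)

reach-embed : ∀ {Λ Λ′} (f : Edge Λ → Edge Λ′) →
              (∀ i → lookup (rels Λ′) (f i) ≡ lookup (rels Λ) i) →
              ∀ {x y} → Reach Λ x y → Reach Λ′ x y
reach-embed {Λ} {Λ′} f f-lookup (_ , nil) = reach-refl
reach-embed {Λ} {Λ′} f f-lookup (_ , cons s w) =
  reach-trans (step-embed s) (reach-embed f f-lookup (_ , w))
  where
  step-embed : (s : Step Λ) → Reach Λ′ (src Λ s) (tgt Λ s)
  step-embed (i , true)  = subst (λ e → Reach Λ′ (proj₁ e) (proj₂ e)) (f-lookup i) (reach-step (f i , true))
  step-embed (i , false) = subst (λ e → Reach Λ′ (proj₂ e) (proj₁ e)) (f-lookup i) (reach-step (f i , false))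

module _ {A : Set} where

  embedˡ : (xs ys : List A) → Fin (length xs) → Fin (length (xs ++ ys))
  embedˡ (_ ∷ xs) ys zero    = zero
  embedˡ (_ ∷ xs) ys (suc i) = suc (embedˡ xs ys i)

  lookup-embedˡ : ∀ xs ys i → lookup (xs ++ ys) (embedˡ xs ys i) ≡ lookup xs i
  lookup-embedˡ (_ ∷ xs) ys zero    = refl
  lookup-embedˡ (_ ∷ xs) ys (suc i) = lookup-embedˡ xs ys i

  embedʳ : (xs ys : List A) → Fin (length ys) → Fin (length (xs ++ ys))
  embedʳ []       ys i = i
  embedʳ (_ ∷ xs) ys i = suc (embedʳ xs ys i)

  lookup-embedʳ : ∀ xs ys i → lookup (xs ++ ys) (embedʳ xs ys i) ≡ lookup ys i
  lookup-embedʳ []       ys i = refl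
  lookup-embedʳ (_ ∷ xs) ys i = lookup-embedʳ xs ys i

reach-⊗ˡ : ∀ Λ₁ Λ₂ {x y} → Reach Λ₁ x y → Reach (Λ₁ ⊗ Λ₂) x y
reach-⊗ˡ Λ₁ Λ₂ = reach-embed (embedˡ (rels Λ₁) (rels Λ₂)) (lookup-embedˡ (rels Λ₁) (rels Λ₂))

reach-⊗ʳ : ∀ Λ₁ Λ₂ {x y} → Reach Λ₂ x y → Reach (Λ₁ ⊗ Λ₂) x y
reach-⊗ʳ Λ₁ Λ₂ = reach-embed (embedʳ (rels Λ₁) (rels Λ₂)) (lookup-embedʳ (rels Λ₁) (rels Λ₂))

occurs-⊗ : ∀ Λ₁ Λ₂ {x} → Occurs (Λ₁ ⊗ Λ₂) x → Occurs Λ₁ x ⊎ Occurs Λ₂ x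
occurs-⊗ Λ₁ Λ₂ (inj₁ o) with Any.++⁻ (rels Λ₁) o
... | inj₁ o₁ = inj₁ (inj₁ o₁)
... | inj₂ o₂ = inj₂ (inj₁ o₂)
occurs-⊗ Λ₁ Λ₂ (inj₂ o) with Any.++⁻ (vars Λ₁) o
... | inj₁ o₁ = inj₁ (inj₂ o₁)
... | inj₂ o₂ = inj₂ (inj₂ o₂)

Rooted : SchSeq → LabelVar → Set
Rooted Λ r = ∀ x → Occurs Λ x → Reach Λ x r

rooted⇒connected : ∀ {Λ r} → Rooted Λ r → Connected Λ
rooted⇒connected rooted x y x∈ y∈ = reach-trans (rooted x x∈) (reach-sym (rooted y y∈))

rooted-⊗ : ∀ Λ₁ Λ₂ {r r′} → Rooted Λ₁ r → Rooted Λ₂ r′ → Reach Λ₁ r′ r → Rooted (Λ₁ ⊗ Λ₂) r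
rooted-⊗ Λ₁ Λ₂ rooted₁ rooted₂ r′⇝r x x∈ with occurs-⊗ Λ₁ Λ₂ x∈
... | inj₁ x∈₁ = reach-⊗ˡ Λ₁ Λ₂ (rooted₁ x x∈₁)
... | inj₂ x∈₂ = reach-trans (reach-⊗ʳ Λ₁ Λ₂ (rooted₂ x x∈₂)) (reach-⊗ˡ Λ₁ Λ₂ r′⇝r)

rooted-relSˡ : ∀ a b → Rooted (relS a b) a
rooted-relSˡ a b x (inj₁ (here (inj₁ refl))) = reach-refl
rooted-relSˡ a b x (inj₁ (here (inj₂ refl))) = reach-step (zero , false)

rooted-relSʳ : ∀ a b → Rooted (relS a b) b
rooted-relSʳ a b x (inj₁ (here (inj₁ refl))) = reach-step (zero , true)
rooted-relSʳ a b x (inj₁ (here (inj₂ refl))) = reach-refl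

upper : LabelVar × LabelVar → LabelVar
upper e = proj₁ e ⊔ proj₂ e

module UpperInjective (Λ : SchSeq)
  (loopless : All (λ e → proj₁ e ≢ proj₂ e) (rels Λ))
  (uppers-distinct : AllPairs (λ e e′ → upper e ≢ upper e′) (rels Λ)) where

  upper-injective : ∀ i j → upper (lookup (rels Λ) i) ≡ upper (lookup (rels Λ) j) → i ≡ j
  upper-injective = go uppers-distinct
    where
    go : ∀ {es} → AllPairs (λ e e′ → upper e ≢ upper e′) es →
         ∀ i j → upper (lookup es i) ≡ upper (lookup es j) → i ≡ j
    go (_ ∷ _)    zero    zero    _  = refl
    go (d ∷ _)    zero    (suc j) eq = ⊥-elim (All.lookup d (∈-lookup j) eq)
    go (d ∷ _)    (suc i) zero    eq = ⊥-elim (All.lookup d (∈-lookup i) (sym eq))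
    go (_ ∷ ds)   (suc i) (suc j) eq = cong suc (go ds i j eq)

  upperˢ : Step Λ → LabelVar
  upperˢ s = upper (lookup (rels Λ) (proj₁ s))

  Ascending Descending : Step Λ → Set
  Ascending s  = src Λ s < tgt Λ s
  Descending s = tgt Λ s < src Λ s

  ascending-or-descending : ∀ s → Ascending s ⊎ Descending s
  ascending-or-descending s with <-cmp (src Λ s) (tgt Λ s)
  ... | tri< up _ _ = inj₁ up
  ... | tri> _ _ down = inj₂ down
  ascending-or-descending (i , true)  | tri≈ _ eq _ = ⊥-elim (All.lookup loopless (∈-lookup i) eq)
  ascending-or-descending (i , false) | tri≈ _ eq _ = ⊥-elim (All.lookup loopless (∈-lookup i) (sym eq))

  ascending⇒tgt≡upper : ∀ s → Ascending s → tgt Λ s ≡ upperˢ s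
  ascending⇒tgt≡upper (i , true)  up = sym (m≤n⇒m⊔n≡n (<⇒≤ up))
  ascending⇒tgt≡upper (i , false) up = sym (m≥n⇒m⊔n≡m (<⇒≤ up))

  descending⇒src≡upper : ∀ s → Descending s → src Λ s ≡ upperˢ s
  descending⇒src≡upper (i , true)  down = sym (m≥n⇒m⊔n≡m (<⇒≤ down))
  descending⇒src≡upper (i , false) down = sym (m≤n⇒m⊔n≡n (<⇒≤ down))

  ascent-then-descent⇒same-edge : ∀ s s′ → Ascending s → Descending s′ → tgt Λ s ≡ src Λ s′ →
                                  proj₁ s ≡ proj₁ s′
  ascent-then-descent⇒same-edge s s′ up down eq = upper-injective _ _
    (trans (sym (ascending⇒tgt≡upper s up)) (trans eq (descending⇒src≡upper s′ down)))

  walk-head : ∀ {x y s ss} → Walk Λ x y (s ∷ ss) → src Λ s ≡ x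
  walk-head (cons _ _) = refl

  AscendsTo : LabelVar → Step Λ → Set
  AscendsTo y t = Ascending t × upperˢ t ≡ y

  TrailShape : LabelVar → LabelVar → Step Λ → List (Step Λ) → Set
  TrailShape x y s ss = (Descending s × y < x) ⊎ (Any (AscendsTo y) (s ∷ ss) × (Descending s ⊎ x < y))

  trail-shape : ∀ {x y s ss} → Walk Λ x y (s ∷ ss) → Unique (map proj₁ (s ∷ ss)) → TrailShape x y s ss
  trail-shape {ss = []} (cons s nil) _ with ascending-or-descending s
  ... | inj₁ up   = inj₂ (here (up , sym (ascending⇒tgt≡upper s up)) , inj₂ up)
  ... | inj₂ down = inj₁ (down , down)
  trail-shape {s = s} {ss = s′ ∷ _} (cons s w) ((s≢s′ ∷ _) ∷ unique) with trail-shape w unique | ascending-or-descending s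
  ... | inj₁ (_ , y<)              | inj₂ down = inj₁ (down , <-trans y< down)
  ... | inj₂ (arrival , _)         | inj₂ down = inj₂ (there arrival , inj₁ down)
  ... | inj₂ (arrival , inj₂ mid<) | inj₁ up   = inj₂ (there arrival , inj₂ (<-trans up mid<))
  ... | inj₁ (down′ , _)           | inj₁ up   =
    ⊥-elim (s≢s′ (ascent-then-descent⇒same-edge s s′ up down′ (sym (walk-head w))))
  ... | inj₂ (_ , inj₁ down′)      | inj₁ up   =
    ⊥-elim (s≢s′ (ascent-then-descent⇒same-edge s s′ up down′ (sym (walk-head w))))

  no-undirected-cycle : ¬ UndirectedCycle Λ
  no-undirected-cycle (x , [] , nonempty , _) = nonempty refl
  no-undirected-cycle (x , s ∷ ss , _ , unique@(s∉ss ∷ _) , w) with trail-shape w unique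
  ... | inj₁ (_ , x<x)                     = <-irrefl refl x<x
  ... | inj₂ (_ , inj₂ x<x)                = <-irrefl refl x<x
  ... | inj₂ (here (up , _) , inj₁ down)   = <-asym up down
  ... | inj₂ (there arrival , inj₁ down)   =
    All.lookupWith (λ s≢t (t-up , t-to-x) → s≢t (upper-injective _ _
                     (trans (sym (descending⇒src≡upper s down)) (trans (walk-head w) (sym t-to-x)))))
                   (All.map⁻ s∉ss) arrival

directed⇒undirected : ∀ {Λ} → DirectedCycle Λ → UndirectedCycle Λ
directed⇒undirected (x , ss , nonempty , unique , _ , w) = x , ss , nonempty , unique , w

below-above-distinct : ∀ {m} {es es′ : List (LabelVar × LabelVar)} →
                       All (λ e → upper e < m) es → All (λ e′ → m ≤ upper e′) es′ →
                       All (λ e → All (λ e′ → upper e ≢ upper e′) es′) es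
below-above-distinct below above =
  All.map (λ e<m → All.map (λ m≤e′ eq → <-irrefl eq (<-≤-trans e<m m≤e′)) above) below

φ-supply-grows : ∀ A w n → n ≤ proj₂ (φ w A n)
φ-supply-grows (atom p) w n = n≤1+n n
φ-supply-grows ⊤ᶠ       w n = ≤-refl
φ-supply-grows (A ∧ᶠ B) w n = ≤-trans (φ-supply-grows A w n) (φ-supply-grows B w _)
φ-supply-grows (F A)    w n = <⇒≤ (φ-supply-grows A n (suc n))
φ-supply-grows (P A)    w n = <⇒≤ (φ-supply-grows A n (suc n))

φ-loopless : ∀ A w n → w < n → All (λ e → proj₁ e ≢ proj₂ e) (rels (proj₁ (φ w A n)))
φ-loopless (atom p) w n w<n = []
φ-loopless ⊤ᶠ       w n w<n = []
φ-loopless (A ∧ᶠ B) w n w<n =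
  All.++⁺ (φ-loopless A w n w<n) (φ-loopless B w _ (<-≤-trans w<n (φ-supply-grows A w n)))
φ-loopless (F A)    w n w<n = <⇒≢ w<n ∷ φ-loopless A n (suc n) (n<1+n n)
φ-loopless (P A)    w n w<n = >⇒≢ w<n ∷ φ-loopless A n (suc n) (n<1+n n)

φ-uppers-fresh : ∀ A w n → w < n →
                 All (λ e → n ≤ upper e × upper e < proj₂ (φ w A n)) (rels (proj₁ (φ w A n)))
φ-uppers-fresh (atom p) w n w<n = []
φ-uppers-fresh ⊤ᶠ       w n w<n = []
φ-uppers-fresh (A ∧ᶠ B) w n w<n =
  All.++⁺ (All.map (λ (n≤e , e<) → n≤e , <-≤-trans e< (φ-supply-grows B w _)) (φ-uppers-fresh A w n w<n))
          (All.map (λ (n₁≤e , e<) → ≤-trans (φ-supply-grows A w n) n₁≤e , e<)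
                   (φ-uppers-fresh B w _ (<-≤-trans w<n (φ-supply-grows A w n))))
φ-uppers-fresh (F A)    w n w<n =
  subst (λ u → n ≤ u × u < _) (sym (m≤n⇒m⊔n≡n (<⇒≤ w<n))) (≤-refl , φ-supply-grows A n (suc n))
  ∷ All.map (λ (n<e , e<) → <⇒≤ n<e , e<) (φ-uppers-fresh A n (suc n) (n<1+n n))
φ-uppers-fresh (P A)    w n w<n =
  subst (λ u → n ≤ u × u < _) (sym (m≥n⇒m⊔n≡m (<⇒≤ w<n))) (≤-refl , φ-supply-grows A n (suc n))
  ∷ All.map (λ (n<e , e<) → <⇒≤ n<e , e<) (φ-uppers-fresh A n (suc n) (n<1+n n))

φ-uppers-distinct : ∀ A w n → w < n → AllPairs (λ e e′ → upper e ≢ upper e′) (rels (proj₁ (φ w A n)))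
φ-uppers-distinct (atom p) w n w<n = []
φ-uppers-distinct ⊤ᶠ       w n w<n = []
φ-uppers-distinct (A ∧ᶠ B) w n w<n =
  AllPairs.++⁺ (φ-uppers-distinct A w n w<n) (φ-uppers-distinct B w _ w<n₁)
    (below-above-distinct (All.map proj₂ (φ-uppers-fresh A w n w<n))
                          (All.map proj₁ (φ-uppers-fresh B w _ w<n₁)))
  where w<n₁ = <-≤-trans w<n (φ-supply-grows A w n)
φ-uppers-distinct (F A)    w n w<n =
  All.map (λ (n<e , _) eq → <-irrefl (trans (sym (m≤n⇒m⊔n≡n (<⇒≤ w<n))) eq) n<e) (φ-uppers-fresh A n (suc n) (n<1+n n))
  ∷ φ-uppers-distinct A n (suc n) (n<1+n n)
φ-uppers-distinct (P A)    w n w<n =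
  All.map (λ (n<e , _) eq → <-irrefl (trans (sym (m≥n⇒m⊔n≡m (<⇒≤ w<n))) eq) n<e) (φ-uppers-fresh A n (suc n) (n<1+n n))
  ∷ φ-uppers-distinct A n (suc n) (n<1+n n)

φ-rooted : ∀ A w n → Rooted (proj₁ (φ w A n)) w
φ-rooted (atom p) w n x (inj₂ (here refl)) = reach-refl
φ-rooted (A ∧ᶠ B) w n =
  rooted-⊗ (proj₁ (φ w A n)) _ (φ-rooted A w n) (φ-rooted B w _) reach-refl
φ-rooted (F A)    w n =
  rooted-⊗ (relS w n) _ (rooted-relSˡ w n) (φ-rooted A n (suc n)) (reach-step (zero , false))
φ-rooted (P A)    w n =
  rooted-⊗ (relS n w) _ (rooted-relSʳ n w) (φ-rooted A n (suc n)) (reach-step (zero , true))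

lemma1 : (A : Fm) (w n : ℕ) → w < n → Polytree (proj₁ (φ w A n))
lemma1 A w n w<n =
  rooted⇒connected (φ-rooted A w n) ,
  (λ cycle → no-undirected-cycle (directed⇒undirected cycle)) ,
  no-undirected-cycle
  where
  open UpperInjective (proj₁ (φ w A n)) (φ-loopless A w n w<n) (φ-uppers-distinct A w n w<n)
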